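{- Let $f:X\to Y$ be a map of sets and let $\mathcal{M}$ be an increasing multi-family on $X$. Then: (i)a. $\operatorname{Out}(f\ast\mathcal{M})\ge f\ast(\operatorname{Out}\mathcal{M})$ (pointwise on subsets of $Y$). (i)b. $\operatorname{Inn}(f\ast\mathcal{M})\le f\ast(\operatorname{Inn}\mathcal{M})$ (pointwise on subsets of $Y$). (ii). If $X$ is a Hausdorff topological space, then $\operatorname{Out}(\operatorname{cl}\mathcal{M})\ge\operatorname{cl}(\operatorname{Out}\mathcal{M})$ (pointwise on subsets of $X$). (iii). If $X$ and $Y$ are Hausdorff topological spaces and $f$ is continuous, then $\operatorname{cl}(f\ast\mathcal{M})\ge f\ast(\operatorname{cl}\mathcal{M})$ (pointwise on subsets of $Y$).
   Context: A multi-family on a set $X$ is a function $\mathcal{M}$ from the power set of $X$ to $\{0,1,2,\ldots,\infty\}$. It is increasing if $S\subseteq S'$ implies $\mathcal{M}(S)\le\mathcal{M}(S')$. For a map $f:X\to Y$, the push $f\ast\mathcal{M}$ is the multi-family on $Y$ given by $(f\ast\mathcal{M})(S)=\mathcal{M}(f^{ -1}(S))$. For an increasing multi-family $\mathcal{M}$: its outer core is $\operatorname{Out}\mathcal{M}(S)=\min\{\sum_{i=1}^k\mathcal{M}(S_i)\mid k\ge1,\ S_1\cup\dots\cup S_k=S\}$, and its inner hull is $\operatorname{Inn}\mathcal{M}(S)=\max\{\sum_{i=1}^k\mathcal{M}(S_i)\mid k\ge1,\ S_1\cup\dots\cup S_k=S,\ S_i\text{ pairwise disjoint}\}$ (maximum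 understood as supremum in $\{0,1,\ldots,\infty\}$). For $X$ a Hausdorff topological space, the closure of an increasing multi-family is $\operatorname{cl}\mathcal{M}(S)=\min\{\mathcal{M}(U)\mid U\subseteq X\text{ open},\ S\subseteq U\}$. Inequalities between multi-families are pointwise, with the usual order on $\{0,1,\ldots,\infty\}$. -}

module Defs where

open import Level using (0ℓ)
open import Data.Nat using (ℕ; zero; suc) renaming (_+_ to _+ℕ_; _≤_ to _≤ℕ_)
open import Data.Fin using (Fin; zero; suc)
open import Data.Product using (Σ; ∃; _×_; _,_)
open import Relation.Unary using (Pred; _⊆_)
open import Relation.Nullary using (¬_)
open import Relation.Binary.PropositionalEquality using (_≡_; _≢_)
open import Function.Bundles using (_⇔_)
open import Data.Unit using (⊤)

data ℕ∞ : Set where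
  fin : ℕ → ℕ∞
  ∞   : ℕ∞

infixl 6 _+∞_
_+∞_ : ℕ∞ → ℕ∞ → ℕ∞
fin m +∞ fin n = fin (m +ℕ n)
fin _ +∞ ∞     = ∞
∞     +∞ _     = ∞

infix 4 _≤∞_
data _≤∞_ : ℕ∞ → ℕ∞ → Set where
  fin≤fin : ∀ {m n} → m ≤ℕ n → fin m ≤∞ fin n
  _≤∞∞    : ∀ x → x ≤∞ ∞

sum∞ : (k : ℕ) → (Fin k → ℕ∞) → ℕ∞
sum∞ zero    a = fin 0
sum∞ (suc k) a = a zero +∞ sum∞ k (λ i → a (suc i))

IsMin : Pred ℕ∞ (Level.suc 0ℓ) → ℕ∞ → Set₁
IsMin P v = P v × (∀ w → P w → v ≤∞ w)

IsSup : Pred ℕ∞ (Level.suc 0ℓ) → ℕ∞ → Set₁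
IsSup P v = (∀ w → P w → w ≤∞ v) × (∀ u → (∀ w → P w → w ≤∞ u) → v ≤∞ u)

Subset : Set → Set₁
Subset X = Pred X 0ℓ

MultiFamily : Set → Set₁
MultiFamily X = Subset X → ℕ∞

Increasing : {X : Set} → MultiFamily X → Set₁
Increasing M = ∀ S S' → S ⊆ S' → M S ≤∞ M S'

preimage : {X Y : Set} → (X → Y) → Subset Y → Subset X
preimage f S = λ x → S (f x)

push : {X Y : Set} → (X → Y) → MultiFamily X → MultiFamily Y
push f M S = M (preimage f S)

UnionIs : {X : Set} {k : ℕ} → (Fin k → Subset X) → Subset X → Set
UnionIs {X} Ss S = ∀ (x : X) → S x ⇔ ∃ (λ i → Ss i x)

PairwiseDisjoint : {X : Set} {k : ℕ} → (Fin k → Subset X) → Set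
PairwiseDisjoint {X} Ss = ∀ i j → i ≢ j → ∀ (x : X) → ¬ (Ss i x × Ss j x)

CoverSums : {X : Set} → MultiFamily X → Subset X → Pred ℕ∞ (Level.suc 0ℓ)
CoverSums {X} M S v =
  Σ ℕ λ k → Σ (Fin (suc k) → Subset X) λ Ss →
    UnionIs Ss S × (sum∞ (suc k) (λ i → M (Ss i)) ≡ v)

PartitionSums : {X : Set} → MultiFamily X → Subset X → Pred ℕ∞ (Level.suc 0ℓ)
PartitionSums {X} M S v =
  Σ ℕ λ k → Σ (Fin (suc k) → Subset X) λ Ss →
    UnionIs Ss S × PairwiseDisjoint Ss × (sum∞ (suc k) (λ i → M (Ss i)) ≡ v)

IsOut : {X : Set} → MultiFamily X → MultiFamily X → Set₁
IsOut M O = ∀ S → IsMin (CoverSums M S) (O S)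

IsInn : {X : Set} → MultiFamily X → MultiFamily X → Set₁
IsInn M I = ∀ S → IsSup (PartitionSums M S) (I S)

record Topology (X : Set) : Set₁ where
  field
    Open     : Subset X → Set
    open-ext : ∀ {U V : Subset X} → Open U → (∀ x → U x ⇔ V x) → Open V
    open-univ : Open (λ _ → ⊤)
    open-∩   : ∀ {U V : Subset X} → Open U → Open V → Open (λ x → U x × V x)
    open-⋃   : ∀ {I : Set} (U : I → Subset X) → (∀ i → Open (U i)) →
               Open (λ x → ∃ λ i → U i x)

open Topology public

Hausdorff : {X : Set} → Topology X → Set₁
Hausdorff {X} τ = ∀ (x y : X) → x ≢ y →
  Σ (Subset X) λ U → Σ (Subset X) λ V →
    Open τ U × Open τ V × U x × V y × (∀ z → ¬ (U z × V z))

Continuous : {X Y : Set} → Topology X → Topology Y → (X → Y) → Set₁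
Continuous τ σ f = ∀ V → Open σ V → Open τ (preimage f V)

OpenNbhdValues : {X : Set} → Topology X → MultiFamily X → Subset X → Pred ℕ∞ (Level.suc 0ℓ)
OpenNbhdValues {X} τ M S v = Σ (Subset X) λ U → Open τ U × S ⊆ U × (M U ≡ v)

IsCl : {X : Set} → Topology X → MultiFamily X → MultiFamily X → Set₁
IsCl τ M C = ∀ S → IsMin (OpenNbhdValues τ M S) (C S)

{-# OPTIONS --safe #-}
module Submission where

open import Defs
open import Data.Product using (_×_; _,_; proj₁; proj₂; ∃)
open import Data.Nat using (zero; suc)
open import Data.Nat.Properties using (≤-trans)
open import Data.Fin using (Fin; zero; suc)
open import Function.Bundles using (mk⇔; Equivalence)
open import Function using (id)
open import Level using (0ℓ)
open import Relation.Unary using (Pred; _⊆_)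
open import Relation.Binary.PropositionalEquality using (_≡_; refl; cong₂)

-- Every inequality compares extrema over two classes of values, one contained in
-- the other: preimages under f turn covers, partitions and open neighbourhoods of
-- S into those of f⁻¹(S), and if Uᵢ is an optimal open neighbourhood of Sᵢ for a
-- cover S₁ ∪ … ∪ S_k = S, then the Uᵢ cover the open neighbourhood ⋃ Uᵢ of S.

≤∞-trans : ∀ {a b c} → a ≤∞ b → b ≤∞ c → a ≤∞ c
≤∞-trans (fin≤fin p) (fin≤fin q) = fin≤fin (≤-trans p q)
≤∞-trans {a} _       (_ ≤∞∞)     = a ≤∞∞

sum∞-cong : ∀ k {a b : Fin k → ℕ∞} → (∀ i → a i ≡ b i) → sum∞ k a ≡ sum∞ k b
sum∞-cong zero    e = refl
sum∞-cong (suc k) e = cong₂ _+∞_ (e zero) (sum∞-cong k (λ i → e (suc i)))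

IsMin-≤ : {P : Pred ℕ∞ (Level.suc 0ℓ)} {v w : ℕ∞} → IsMin P v → P w → v ≤∞ w
IsMin-≤ (_ , v≤P) = v≤P _

IsMin-mono : {P Q : Pred ℕ∞ (Level.suc 0ℓ)} {v u : ℕ∞} →
             Q ⊆ P → IsMin P v → IsMin Q u → v ≤∞ u
IsMin-mono Q⊆P minP (Qu , _) = IsMin-≤ minP (Q⊆P Qu)

IsSup-mono : {P Q : Pred ℕ∞ (Level.suc 0ℓ)} {v u : ℕ∞} →
             P ⊆ Q → IsSup P v → IsSup Q u → v ≤∞ u
IsSup-mono P⊆Q (_ , v-least) (Q≤u , _) = v-least _ (λ w Pw → Q≤u w (P⊆Q Pw))

module _ {X Y : Set} (f : X → Y) (M : MultiFamily X) where

  coverSums-push : ∀ S → CoverSums (push f M) S ⊆ CoverSums M (preimage f S)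
  coverSums-push S (k , Ss , ⋃Ss≡S , sum≡v) =
    k , (λ i → preimage f (Ss i)) , (λ x → ⋃Ss≡S (f x)) , sum≡v

  partitionSums-push : ∀ S → PartitionSums (push f M) S ⊆ PartitionSums M (preimage f S)
  partitionSums-push S (k , Ss , ⋃Ss≡S , disjoint , sum≡v) =
    k , (λ i → preimage f (Ss i)) , (λ x → ⋃Ss≡S (f x)) ,
    (λ i j i≢j x → disjoint i j i≢j (f x)) , sum≡v

  push-out-≤-out-push : ∀ {OfM OM} → IsOut (push f M) OfM → IsOut M OM →
                        ∀ S → push f OM S ≤∞ OfM S
  push-out-≤-out-push isOfM isOM S =
    IsMin-mono (coverSums-push S) (isOM (preimage f S)) (isOfM S)

  inn-push-≤-push-inn : ∀ {IfM IM} → IsInn (push f M) IfM → IsInn M IM →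
                        ∀ S → IfM S ≤∞ push f IM S
  inn-push-≤-push-inn isIfM isIM S =
    IsSup-mono (partitionSums-push S) (isIfM S) (isIM (preimage f S))

  openNbhdValues-push : ∀ (τ : Topology X) (σ : Topology Y) → Continuous τ σ f →
    ∀ S → OpenNbhdValues σ (push f M) S ⊆ OpenNbhdValues τ M (preimage f S)
  openNbhdValues-push τ σ cont S (V , open-V , S⊆V , MV≡v) =
    preimage f V , cont V open-V , S⊆V , MV≡v

  push-cl-≤-cl-push : ∀ (τ : Topology X) (σ : Topology Y) → Continuous τ σ f →
    ∀ {ClfM CM} → IsCl σ (push f M) ClfM → IsCl τ M CM →
    ∀ S → push f CM S ≤∞ ClfM S
  push-cl-≤-cl-push τ σ cont isClfM isCM S =
    IsMin-mono (openNbhdValues-push τ σ cont S) (isCM (preimage f S)) (isClfM S)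

module _ {X : Set} (τ : Topology X) (M : MultiFamily X) {CM : MultiFamily X}
         (isCM : IsCl τ M CM) where

  nbhd : Subset X → Subset X
  nbhd S = proj₁ (proj₁ (isCM S))

  open-nbhd : ∀ S → Open τ (nbhd S)
  open-nbhd S = proj₁ (proj₂ (proj₁ (isCM S)))

  ⊆-nbhd : ∀ S → S ⊆ nbhd S
  ⊆-nbhd S = proj₁ (proj₂ (proj₂ (proj₁ (isCM S))))

  M-nbhd : ∀ S → M (nbhd S) ≡ CM S
  M-nbhd S = proj₂ (proj₂ (proj₂ (proj₁ (isCM S))))

  cl-out-≤-coverSums-cl : ∀ {OM COM} → IsOut M OM → IsCl τ OM COM →
    ∀ S {v} → CoverSums CM S v → COM S ≤∞ v
  cl-out-≤-coverSums-cl isOM isCOM S (k , Ss , ⋃Ss≡S , refl) =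
    ≤∞-trans (IsMin-≤ (isCOM S) (U , open-U , S⊆U , refl))
             (IsMin-≤ (isOM U) (k , Us , (λ _ → mk⇔ id id) ,
                                sum∞-cong (suc k) (λ i → M-nbhd (Ss i))))
    where
    Us : Fin (suc k) → Subset X
    Us i = nbhd (Ss i)
    U : Subset X
    U x = ∃ λ i → Us i x
    open-U : Open τ U
    open-U = open-⋃ τ Us (λ i → open-nbhd (Ss i))
    S⊆U : S ⊆ U
    S⊆U Sx with Equivalence.to (⋃Ss≡S _) Sx
    ... | i , Ssix = i , ⊆-nbhd (Ss i) Ssix

  cl-out-≤-out-cl : ∀ {OCM OM COM} → IsOut CM OCM → IsOut M OM → IsCl τ OM COM →
    ∀ S → COM S ≤∞ OCM S
  cl-out-≤-out-cl isOCM isOM isCOM S =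
    cl-out-≤-coverSums-cl isOM isCOM S (proj₁ (isOCM S))

mainTheorem1 : {X Y : Set} (f : X → Y) (M : MultiFamily X) → Increasing M →
    -- (i)a  Out(f ∗ M) ≥ f ∗ (Out M)
    ((OfM : MultiFamily Y) → IsOut (push f M) OfM →
      (OM : MultiFamily X) → IsOut M OM →
      ∀ S → push f OM S ≤∞ OfM S)
    ×
    -- (i)b  Inn(f ∗ M) ≤ f ∗ (Inn M)
    ((IfM : MultiFamily Y) → IsInn (push f M) IfM →
      (IM : MultiFamily X) → IsInn M IM →
      ∀ S → IfM S ≤∞ push f IM S)
    ×
    -- (ii)  X Hausdorff:  Out(cl M) ≥ cl(Out M)
    ((τ : Topology X) → Hausdorff τ →
      (CM : MultiFamily X) → IsCl τ M CM →
      (OCM : MultiFamily X) → IsOut CM OCM →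
      (OM : MultiFamily X) → IsOut M OM →
      (COM : MultiFamily X) → IsCl τ OM COM →
      ∀ S → COM S ≤∞ OCM S)
    ×
    -- (iii)  X, Y Hausdorff, f continuous:  cl(f ∗ M) ≥ f ∗ (cl M)
    ((τ : Topology X) (σ : Topology Y) → Hausdorff τ → Hausdorff σ →
      Continuous τ σ f →
      (ClfM : MultiFamily Y) → IsCl σ (push f M) ClfM →
      (CM : MultiFamily X) → IsCl τ M CM →
      ∀ S → push f CM S ≤∞ ClfM S)
mainTheorem1 f M _ =
  (λ _ isOfM _ isOM → push-out-≤-out-push f M isOfM isOM) ,
  (λ _ isIfM _ isIM → inn-push-≤-push-inn f M isIfM isIM) ,
  (λ τ _ _ isCM _ isOCM _ isOM _ isCOM → cl-out-≤-out-cl τ M isCM isOCM isOM isCOM) ,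
  (λ τ σ _ _ cont _ isClfM _ isCM → push-cl-≤-cl-push f M τ σ cont isClfM isCM)
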